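{- For $n\ge1$, $$\Gamma_{n+1}(y,q)=\Gamma_n(y,q)+y\sum_{i=1}^{n-1}q^i{n\brack i}_q\Gamma_i(y,q)\Gamma_{n-i}(y,q),$$ $$\widetilde{\Gamma}_{n+1}(y,q)=y\,\Gamma_n(y,q)+y\sum_{i=2}^{n-1}q^i{n\brack i}_q\widetilde{\Gamma}_i(y,q)\Gamma_{n-i}(y,q),$$ with $\Gamma_0=\Gamma_1=\widetilde{\Gamma}_0=1$ and $\widetilde{\Gamma}_1=0$.
   Context: For $\sigma\in\mathfrak{S}_n$: $\mathrm{des}(\sigma)=|\{i\in[n-1]:\sigma_i>\sigma_{i+1}\}|$, $\mathrm{inv}(\sigma)$ is the number of pairs $i<j$ with $\sigma_i>\sigma_j$; with $\sigma_0=\sigma_{n+1}=+\infty$, $\sigma_i$ is a double descent if $\sigma_{i-1}>\sigma_i>\sigma_{i+1}$, and $\mathrm{dd}(\sigma)$ counts them. $\mathfrak{D}_{n,k}=\{\sigma\in\mathfrak{S}_n:\mathrm{dd}(\sigma)=0,\ \mathrm{des}(\sigma)=k\}$, $\widetilde{\mathfrak{D}}_{n,k}=\{\sigma\in\mathfrak{D}_{n,k-1}:\sigma_{n-1}<\sigma_n\}$. For $n\ge1$, $\Gamma_n(y,q)=\sum_{k=0}^{\lfloor(n-1)/2\rfloor}\bigl(\sum_{\sigma\in\mathfrak{D}_{n,k}}q^{\mathrm{inv}(\sigma)}\bigr)y^k$ and $\widetilde{\Gamma}_n(y,q)=\sum_{k=1}^{\lfloor n/2\rfloor}\bigl(\sum_{\sigma\in\widetilde{\mathfrak{D}}_{n,k}}q^{\mathrm{inv}(\sigma)}\bigr)y^k$;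 $\Gamma_0=\widetilde{\Gamma}_0=1$. $(q;q)_n=\prod_{i=1}^n(1-q^i)$, $(q;q)_0=1$, ${n\brack k}_q=(q;q)_n/((q;q)_k(q;q)_{n-k})$. -}

module Defs where

open import Data.Nat using (ℕ; zero; suc; _+_; _*_; _∸_; _^_; _/_; _<ᵇ_; _≡ᵇ_; ⌊_/2⌋)
open import Data.Bool using (Bool; true; false; _∧_; if_then_else_)
open import Data.List using (List; []; _∷_; _++_; map; concatMap; upTo; filter; [_])
open import Data.Nat.ListAction using (sum)

-- sumFromTo a b f = f a + f (a+1) + ... + f b   (empty, i.e. 0, if b < a)
sumFromTo : ℕ → ℕ → (ℕ → ℕ) → ℕ
sumFromTo a b f = sum (map (λ i → f (a + i)) (upTo (suc b ∸ a)))

-- Permutations of [n] = {1,…,n}, in one-line notation σ₁ σ₂ … σₙ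

insertions : ℕ → List ℕ → List (List ℕ)
insertions x []       = (x ∷ []) ∷ []
insertions x (y ∷ ys) = (x ∷ y ∷ ys) ∷ map (y ∷_) (insertions x ys)

-- all permutations of a list (each exactly once when entries are distinct)
permutations : List ℕ → List (List ℕ)
permutations []       = [] ∷ []
permutations (x ∷ xs) = concatMap (insertions x) (permutations xs)

oneTo : ℕ → List ℕ
oneTo n = map suc (upTo n)

S : ℕ → List (List ℕ)
S n = permutations (oneTo n)

des : List ℕ → ℕ
des []           = 0
des (x ∷ [])     = 0
des (x ∷ y ∷ zs) = (if y <ᵇ x then 1 else 0) + des (y ∷ zs)

inv : List ℕ → ℕ
inv []       = 0
inv (x ∷ xs) = sum (map (λ y → if y <ᵇ x then 1 else 0) xs) + inv xs

data ℕ∞ : Set where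
  fin : ℕ → ℕ∞
  ∞   : ℕ∞

_>∞_ : ℕ∞ → ℕ∞ → Bool
∞     >∞ ∞     = false
∞     >∞ fin _ = true
fin _ >∞ ∞     = false
fin a >∞ fin b = b <ᵇ a

ddTriples : List ℕ∞ → ℕ
ddTriples (a ∷ b ∷ c ∷ rest) = (if (a >∞ b) ∧ (b >∞ c) then 1 else 0) + ddTriples (b ∷ c ∷ rest)
ddTriples _ = 0

dd : List ℕ → ℕ
dd σ = ddTriples (∞ ∷ map fin σ ++ [ ∞ ])

lastAscent : List ℕ → Bool
lastAscent (x ∷ y ∷ [])     = x <ᵇ y
lastAscent (x ∷ y ∷ z ∷ zs) = lastAscent (y ∷ z ∷ zs)
lastAscent _                = false

D : ℕ → ℕ → List (List ℕ)
D n k = filter (λ σ → Data.Bool.T? ((dd σ ≡ᵇ 0) ∧ (des σ ≡ᵇ k))) (S n)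
  where import Data.Bool

D~ : ℕ → ℕ → List (List ℕ)
D~ n k = filter (λ σ → Data.Bool.T? (lastAscent σ)) (D n (k ∸ 1))
  where import Data.Bool

invSum : ℕ → List (List ℕ) → ℕ
invSum q A = sum (map (λ σ → q ^ inv σ) A)

-- Γₙ(y,q) and Γ̃ₙ(y,q), evaluated at natural numbers y, q

Γ : ℕ → ℕ → ℕ → ℕ
Γ zero    y q = 1
Γ (suc m) y q = sumFromTo 0 ⌊ m /2⌋ (λ k → invSum q (D (suc m) k) * y ^ k)

Γ~ : ℕ → ℕ → ℕ → ℕ
Γ~ zero    y q = 1
Γ~ (suc m) y q = sumFromTo 1 ⌊ suc m /2⌋ (λ k → invSum q (D~ (suc m) k) * y ^ k)

-- (q;q)ₙ up to the sign (-1)ⁿ:  ∏_{i=1}^n (q^i - 1)   (for q ≥ 2 this is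
-- (-1)ⁿ (q;q)ₙ, and the signs cancel in the Gaussian binomial)
qPoch± : ℕ → ℕ → ℕ
qPoch± q zero    = 1
qPoch± q (suc n) = qPoch± q n * (q ^ suc n ∸ 1)

-- total division (only ever used with a nonzero divisor)
_div_ : ℕ → ℕ → ℕ
m div zero    = 0
m div (suc d) = m / suc d

-- [n k]_q = (q;q)ₙ / ((q;q)ₖ (q;q)ₙ₋ₖ)   for 0 ≤ k ≤ n, q ≥ 2
qBinom : ℕ → ℕ → ℕ → ℕ
qBinom q n k = qPoch± q n div (qPoch± q k * qPoch± q (n ∸ k))

-- Split a permutation of a strictly decreasing list m ∷ L at its maximum: σ = α ++ m ∷ β, where
-- (A, B) ranges over the interleavings of L and α, β over the permutations of A and B. Since σ₀ = +∞,
-- σ has a double descent if α is empty and β is not; otherwise dd and des add up (m creating one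
-- extra descent when β ≠ []), and inv σ = inv α + inv β + |β| + (pairs a ∈ α, b ∈ β with a > b).
-- Summed over the interleavings, the last term produces the Gaussian binomial through the
-- q-Pascal rule, and the inner sums depend only on |A| and |B|: strong induction shows that the
-- weighted sum over the permutations of a decreasing list only depends on its length.

module Submission where

open import Defs

open import Data.Bool using (Bool; true; false; _∧_; if_then_else_; T?)
open import Data.Bool.Properties using (∧-zeroʳ; T-≡)
open import Data.Empty using (⊥-elim)
open import Data.List
  using (List; []; _∷_; _++_; [_]; length; map; filter; concatMap; upTo; applyUpTo; applyDownFrom)
open import Data.List.Properties
  using (map-∘; map-upTo; reverse-applyUpTo; length-map; length-upTo; length-applyDownFrom)
import Data.List.Relation.Binary.Permutation.Propositional as ↭
open ↭ using (_↭_; prep; swap; ↭-refl; ↭-sym; ↭-trans; ↭-reflexive)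
import Data.List.Relation.Binary.Permutation.Propositional.Properties as ↭ₚ
open import Data.List.Relation.Ternary.Interleaving.Propositional
  using (Interleaving; []; consˡ; consʳ; toPermutation)
open import Data.List.Relation.Ternary.Interleaving.Properties using (interleave-length)
open import Data.List.Relation.Unary.All as All using (All; []; _∷_)
import Data.List.Relation.Unary.All.Properties as Allₚ
open import Data.List.Relation.Unary.AllPairs as AllPairs using (AllPairs; []; _∷_)
import Data.List.Relation.Unary.AllPairs.Properties as AllPairsₚ
open import Data.Nat
  using (ℕ; zero; suc; _+_; _*_; _^_; _∸_; _>_; _≤_; _<_; z≤n; s≤s; z<s; s<s; _<ᵇ_; _≡ᵇ_; ⌊_/2⌋; >-nonZero)
open import Data.Nat.DivMod using (m*n/n≡m)
open import Data.Nat.ListAction using (sum)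
open import Data.Nat.ListAction.Properties using (sum-↭)
open import Data.Nat.Properties
open import Algebra.Properties.CommutativeSemigroup +-commutativeSemigroup
  using () renaming (interchange to +-interchange)
open import Data.Nat.Tactic.RingSolver using (solve-∀)
open import Data.Product using (_×_; _,_; proj₁; proj₂)
open import Function using (_∘_; Equivalence)
open import Relation.Binary.PropositionalEquality hiding ([_])
open import Relation.Nullary using (¬_)

private variable A B : Set

sumBy : List A → (A → ℕ) → ℕ
sumBy xs f = sum (map f xs)

sumBy-cong : ∀ xs {f g : A → ℕ} → (∀ x → f x ≡ g x) → sumBy xs f ≡ sumBy xs g
sumBy-cong []       f≗g = refl
sumBy-cong (x ∷ xs) f≗g = cong₂ _+_ (f≗g x) (sumBy-cong xs f≗g)

sumBy-congᴬ : ∀ {P : A → Set} {xs} {f g : A → ℕ} →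
              All P xs → (∀ {x} → P x → f x ≡ g x) → sumBy xs f ≡ sumBy xs g
sumBy-congᴬ []         f≗g = refl
sumBy-congᴬ (px ∷ pxs) f≗g = cong₂ _+_ (f≗g px) (sumBy-congᴬ pxs f≗g)

sumBy-↭ : ∀ {xs ys} (f : A → ℕ) → xs ↭ ys → sumBy xs f ≡ sumBy ys f
sumBy-↭ f xs↭ys = sum-↭ (↭ₚ.map⁺ f xs↭ys)

sumBy-++ : ∀ xs ys (f : A → ℕ) → sumBy (xs ++ ys) f ≡ sumBy xs f + sumBy ys f
sumBy-++ []       ys f = refl
sumBy-++ (x ∷ xs) ys f = trans (cong (f x +_) (sumBy-++ xs ys f)) (sym (+-assoc (f x) _ _))

sumBy-map : ∀ xs (g : A → B) (f : B → ℕ) → sumBy (map g xs) f ≡ sumBy xs (f ∘ g)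
sumBy-map xs g f = cong sum (sym (map-∘ xs))

sumBy-concatMap : ∀ xs (g : A → List B) (f : B → ℕ) →
                  sumBy (concatMap g xs) f ≡ sumBy xs (λ x → sumBy (g x) f)
sumBy-concatMap []       g f = refl
sumBy-concatMap (x ∷ xs) g f =
  trans (sumBy-++ (g x) (concatMap g xs) f) (cong (sumBy (g x) f +_) (sumBy-concatMap xs g f))

sumBy-+ : ∀ xs (f g : A → ℕ) → sumBy xs (λ x → f x + g x) ≡ sumBy xs f + sumBy xs g
sumBy-+ []       f g = refl
sumBy-+ (x ∷ xs) f g =
  trans (cong (f x + g x +_) (sumBy-+ xs f g)) (+-interchange (f x) (g x) _ _)

sumBy-*ˡ : ∀ xs c (f : A → ℕ) → sumBy xs (λ x → c * f x) ≡ c * sumBy xs f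
sumBy-*ˡ []       c f = sym (*-zeroʳ c)
sumBy-*ˡ (x ∷ xs) c f = trans (cong (c * f x +_) (sumBy-*ˡ xs c f)) (sym (*-distribˡ-+ c (f x) _))

sumBy-*ʳ : ∀ xs c (f : A → ℕ) → sumBy xs (λ x → f x * c) ≡ sumBy xs f * c
sumBy-*ʳ xs c f =
  trans (sumBy-cong xs (λ x → *-comm (f x) c)) (trans (sumBy-*ˡ xs c f) (*-comm c _))

sumBy-zero : ∀ (xs : List A) → sumBy xs (λ _ → 0) ≡ 0
sumBy-zero []       = refl
sumBy-zero (x ∷ xs) = sumBy-zero xs

sumBy-comm : ∀ xs ys (f : A → B → ℕ) →
             sumBy xs (λ x → sumBy ys (f x)) ≡ sumBy ys (λ y → sumBy xs (λ x → f x y))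
sumBy-comm []       ys f = sym (sumBy-zero ys)
sumBy-comm (x ∷ xs) ys f =
  trans (cong (sumBy ys (f x) +_) (sumBy-comm xs ys f)) (sym (sumBy-+ ys (f x) _))

sumBy-* : ∀ xs ys (f : A → ℕ) (g : B → ℕ) →
          sumBy xs (λ x → sumBy ys (λ y → f x * g y)) ≡ sumBy xs f * sumBy ys g
sumBy-* xs ys f g = trans (sumBy-cong xs (λ x → sumBy-*ˡ ys (f x) g)) (sumBy-*ʳ xs (sumBy ys g) f)

sumBy-filter : ∀ (b : A → Bool) xs (g : A → ℕ) →
               sumBy (filter (λ x → T? (b x)) xs) g ≡ sumBy xs (λ x → if b x then g x else 0)
sumBy-filter b []       g = refl
sumBy-filter b (x ∷ xs) g with b x
... | true  = cong (g x +_) (sumBy-filter b xs g)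
... | false = sumBy-filter b xs g

sumBelow : ℕ → (ℕ → ℕ) → ℕ
sumBelow zero    f = 0
sumBelow (suc n) f = f 0 + sumBelow n (f ∘ suc)

sumBy-applyUpTo : ∀ n (g : ℕ → ℕ) (f : ℕ → ℕ) → sumBy (applyUpTo g n) f ≡ sumBelow n (f ∘ g)
sumBy-applyUpTo zero    g f = refl
sumBy-applyUpTo (suc n) g f = cong (f (g 0) +_) (sumBy-applyUpTo n (g ∘ suc) f)

sumBelow-cong : ∀ n {f g : ℕ → ℕ} → (∀ {i} → i < n → f i ≡ g i) → sumBelow n f ≡ sumBelow n g
sumBelow-cong zero    f≗g = refl
sumBelow-cong (suc n) f≗g = cong₂ _+_ (f≗g z<s) (sumBelow-cong n (f≗g ∘ s<s))

sumBelow-suc : ∀ n (f : ℕ → ℕ) → sumBelow (suc n) f ≡ sumBelow n f + f n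
sumBelow-suc zero    f = +-comm (f 0) 0
sumBelow-suc (suc n) f = trans (cong (f 0 +_) (sumBelow-suc n (f ∘ suc))) (sym (+-assoc (f 0) _ _))

sumBelow-+ : ∀ n (f g : ℕ → ℕ) → sumBelow n (λ i → f i + g i) ≡ sumBelow n f + sumBelow n g
sumBelow-+ zero    f g = refl
sumBelow-+ (suc n) f g =
  trans (cong (f 0 + g 0 +_) (sumBelow-+ n (f ∘ suc) (g ∘ suc))) (+-interchange (f 0) (g 0) _ _)

sumBelow-*ˡ : ∀ n c (f : ℕ → ℕ) → sumBelow n (λ i → c * f i) ≡ c * sumBelow n f
sumBelow-*ˡ zero    c f = sym (*-zeroʳ c)
sumBelow-*ˡ (suc n) c f =
  trans (cong (c * f 0 +_) (sumBelow-*ˡ n c (f ∘ suc))) (sym (*-distribˡ-+ c (f 0) _))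

sumBelow-zero : ∀ n → sumBelow n (λ _ → 0) ≡ 0
sumBelow-zero zero    = refl
sumBelow-zero (suc n) = sumBelow-zero n

sumBelow-≡ᵇ : ∀ {N d} c (f : ℕ → ℕ) → d < N → sumBelow N (λ k → (if d ≡ᵇ k then c else 0) * f k) ≡ c * f d
sumBelow-≡ᵇ {suc N} {zero}  c f _         = trans (cong (c * f 0 +_) (sumBelow-zero N)) (+-identityʳ _)
sumBelow-≡ᵇ {suc N} {suc d} c f (s≤s d<N) = sumBelow-≡ᵇ c (f ∘ suc) d<N

sumBelow-sumBy : ∀ n xs (f : ℕ → A → ℕ) →
                 sumBelow n (λ i → sumBy xs (f i)) ≡ sumBy xs (λ x → sumBelow n (λ i → f i x))
sumBelow-sumBy zero    xs f = sym (sumBy-zero xs)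
sumBelow-sumBy (suc n) xs f =
  trans (cong (sumBy xs (f 0) +_) (sumBelow-sumBy n xs (f ∘ suc))) (sym (sumBy-+ xs (f 0) _))

sumBy-permutations-∷ : ∀ x L (f : List ℕ → ℕ) →
  sumBy (permutations (x ∷ L)) f ≡ sumBy (permutations L) (λ ρ → sumBy (insertions x ρ) f)
sumBy-permutations-∷ x L f = sumBy-concatMap (permutations L) (insertions x) f

sumBy-insertions-∷ : ∀ x t τ (f : List ℕ → ℕ) →
  sumBy (insertions x (t ∷ τ)) f ≡ f (x ∷ t ∷ τ) + sumBy (insertions x τ) (f ∘ (t ∷_))
sumBy-insertions-∷ x t τ f = cong (f (x ∷ t ∷ τ) +_) (sumBy-map (insertions x τ) (t ∷_) f)

insertions-comm : ∀ x y τ (h : List ℕ → ℕ) →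
  sumBy (insertions y τ) (λ ρ → sumBy (insertions x ρ) h) ≡
  sumBy (insertions x τ) (λ ρ → sumBy (insertions y ρ) h)
insertions-comm x y []      h = rearrange (h (x ∷ y ∷ [])) (h (y ∷ x ∷ []))
  where
  rearrange : ∀ a b → a + (b + 0) + 0 ≡ b + (a + 0) + 0
  rearrange = solve-∀
insertions-comm x y (t ∷ τ) h = begin
  sumBy (insertions y (t ∷ τ)) (λ ρ → sumBy (insertions x ρ) h)
    ≡⟨ expand x y ⟩
  (h (x ∷ y ∷ t ∷ τ) + (h (y ∷ x ∷ t ∷ τ) + front x y)) + (front y x + behind x y)
    ≡⟨ cong (λ c → (h (x ∷ y ∷ t ∷ τ) + (h (y ∷ x ∷ t ∷ τ) + front x y)) + (front y x + c))
            (insertions-comm x y τ (h ∘ (t ∷_))) ⟩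
  (h (x ∷ y ∷ t ∷ τ) + (h (y ∷ x ∷ t ∷ τ) + front x y)) + (front y x + behind y x)
    ≡⟨ rearrange (h (x ∷ y ∷ t ∷ τ)) (h (y ∷ x ∷ t ∷ τ)) (front x y) (front y x) (behind y x) ⟩
  (h (y ∷ x ∷ t ∷ τ) + (h (x ∷ y ∷ t ∷ τ) + front y x)) + (front x y + behind y x)
    ≡⟨ sym (expand y x) ⟩
  sumBy (insertions x (t ∷ τ)) (λ ρ → sumBy (insertions y ρ) h) ∎
  where
  open ≡-Reasoning
  front : ℕ → ℕ → ℕ
  front x y = sumBy (insertions x τ) (λ π → h (y ∷ t ∷ π))
  behind : ℕ → ℕ → ℕ
  behind x y = sumBy (insertions y τ) (λ ρ → sumBy (insertions x ρ) (h ∘ (t ∷_)))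
  expand : ∀ x y → sumBy (insertions y (t ∷ τ)) (λ ρ → sumBy (insertions x ρ) h) ≡
                   (h (x ∷ y ∷ t ∷ τ) + (h (y ∷ x ∷ t ∷ τ) + front x y)) + (front y x + behind x y)
  expand x y = cong₂ _+_
    (trans (sumBy-insertions-∷ x y (t ∷ τ) h)
             (cong (h (x ∷ y ∷ t ∷ τ) +_) (sumBy-insertions-∷ x t τ (h ∘ (y ∷_)))))
    (trans (sumBy-map (insertions y τ) (t ∷_) (λ ρ → sumBy (insertions x ρ) h))
             (trans (sumBy-cong (insertions y τ) (λ ρ → sumBy-insertions-∷ x t ρ h))
                      (sumBy-+ (insertions y τ) (λ ρ → h (x ∷ t ∷ ρ)) _)))
  rearrange : ∀ a b c d e → (a + (b + c)) + (d + e) ≡ (b + (a + d)) + (c + e)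
  rearrange = solve-∀

sumBy-permutations-∷∷ : ∀ x y L (f : List ℕ → ℕ) →
  sumBy (permutations (x ∷ y ∷ L)) f ≡
  sumBy (permutations L) (λ τ → sumBy (insertions y τ) (λ ρ → sumBy (insertions x ρ) f))
sumBy-permutations-∷∷ x y L f =
  trans (sumBy-permutations-∷ x (y ∷ L) f) (sumBy-permutations-∷ y L _)

sumBy-permutations-↭ : ∀ {L L′} → L ↭ L′ → (f : List ℕ → ℕ) →
  sumBy (permutations L) f ≡ sumBy (permutations L′) f
sumBy-permutations-↭ ↭.refl f = refl
sumBy-permutations-↭ (prep {xs} {ys} x p) f = begin
  sumBy (permutations (x ∷ xs)) f                               ≡⟨ sumBy-permutations-∷ x xs f ⟩
  sumBy (permutations xs) (λ ρ → sumBy (insertions x ρ) f)     ≡⟨ sumBy-permutations-↭ p _ ⟩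
  sumBy (permutations ys) (λ ρ → sumBy (insertions x ρ) f)     ≡⟨ sumBy-permutations-∷ x ys f ⟨
  sumBy (permutations (x ∷ ys)) f                               ∎
  where open ≡-Reasoning
sumBy-permutations-↭ (swap {xs} {ys} x y p) f = begin
  sumBy (permutations (x ∷ y ∷ xs)) f
    ≡⟨ sumBy-permutations-∷∷ x y xs f ⟩
  sumBy (permutations xs) (λ τ → sumBy (insertions y τ) (λ ρ → sumBy (insertions x ρ) f))
    ≡⟨ sumBy-permutations-↭ p _ ⟩
  sumBy (permutations ys) (λ τ → sumBy (insertions y τ) (λ ρ → sumBy (insertions x ρ) f))
    ≡⟨ sumBy-cong (permutations ys) (λ τ → insertions-comm x y τ f) ⟩
  sumBy (permutations ys) (λ τ → sumBy (insertions x τ) (λ ρ → sumBy (insertions y ρ) f))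
    ≡⟨ sumBy-permutations-∷∷ y x ys f ⟨
  sumBy (permutations (y ∷ x ∷ ys)) f ∎
  where open ≡-Reasoning
sumBy-permutations-↭ (↭.trans p p′) f =
  trans (sumBy-permutations-↭ p f) (sumBy-permutations-↭ p′ f)

insertions-↭ : ∀ x ρ → All (_↭ x ∷ ρ) (insertions x ρ)
insertions-↭ x []      = ↭-refl ∷ []
insertions-↭ x (t ∷ ρ) =
  ↭-refl ∷ Allₚ.map⁺ (All.map (λ σ↭ → ↭-trans (prep t σ↭) (swap t x ↭-refl)) (insertions-↭ x ρ))

permutations-↭ : ∀ L → All (_↭ L) (permutations L)
permutations-↭ []      = ↭-refl ∷ []
permutations-↭ (x ∷ L) = Allₚ.concat⁺ (Allₚ.map⁺ (All.map
  (λ ρ↭L → All.map (λ σ↭ → ↭-trans σ↭ (prep x ρ↭L)) (insertions-↭ x _)) (permutations-↭ L)))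

sumBy-permutations-cong : ∀ L {f g : List ℕ → ℕ} → (∀ {σ} → σ ↭ L → f σ ≡ g σ) →
  sumBy (permutations L) f ≡ sumBy (permutations L) g
sumBy-permutations-cong L = sumBy-congᴬ (permutations-↭ L)

length-oneTo : ∀ n → length (oneTo n) ≡ n
length-oneTo n = trans (length-map suc (upTo n)) (length-upTo n)

sumBy-permutations-≡0 : ∀ L {f : List ℕ → ℕ} → (∀ {σ} → σ ↭ L → f σ ≡ 0) → sumBy (permutations L) f ≡ 0
sumBy-permutations-≡0 L f≡0 = trans (sumBy-permutations-cong L f≡0) (sumBy-zero (permutations L))

All-↭ : ∀ {P : A → Set} {σ L} → σ ↭ L → All P L → All P σ
All-↭ σ↭L = ↭ₚ.All-resp-↭ (↭-sym σ↭L)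

¬[]↭x∷xs : ∀ {x} {xs : List A} → ¬ ([] ↭ x ∷ xs)
¬[]↭x∷xs = ↭ₚ.¬x∷xs↭[] ∘ ↭-sym

oneTo↭downFrom : ∀ n → oneTo n ↭ applyDownFrom suc n
oneTo↭downFrom n = ↭-trans (↭-reflexive (map-upTo suc n))
  (↭-trans (↭-sym (↭ₚ.↭-reverse (applyUpTo suc n))) (↭-reflexive (reverse-applyUpTo suc n)))

sumCuts : List A → (List A → List A → ℕ) → ℕ
sumCuts []       Φ = Φ [] []
sumCuts (x ∷ xs) Φ = Φ [] (x ∷ xs) + sumCuts xs (λ a b → Φ (x ∷ a) b)

sumCuts-cong : ∀ (xs : List A) {Φ Ψ} → (∀ a b → Φ a b ≡ Ψ a b) → sumCuts xs Φ ≡ sumCuts xs Ψ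
sumCuts-cong []       Φ≗Ψ = Φ≗Ψ [] []
sumCuts-cong (x ∷ xs) Φ≗Ψ = cong₂ _+_ (Φ≗Ψ [] (x ∷ xs)) (sumCuts-cong xs (λ a → Φ≗Ψ (x ∷ a)))

sumCuts-+ : ∀ (xs : List A) Φ Ψ → sumCuts xs (λ a b → Φ a b + Ψ a b) ≡ sumCuts xs Φ + sumCuts xs Ψ
sumCuts-+ []       Φ Ψ = refl
sumCuts-+ (x ∷ xs) Φ Ψ = trans (cong (Φ [] (x ∷ xs) + Ψ [] (x ∷ xs) +_) (sumCuts-+ xs _ _))
                               (+-interchange (Φ [] (x ∷ xs)) (Ψ [] (x ∷ xs)) _ _)

sumBy-insertions : ∀ x τ (f : List ℕ → ℕ) → sumBy (insertions x τ) f ≡ sumCuts τ (λ a b → f (a ++ x ∷ b))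
sumBy-insertions x []      f = +-identityʳ (f (x ∷ []))
sumBy-insertions x (t ∷ τ) f =
  trans (sumBy-insertions-∷ x t τ f) (cong (f (x ∷ t ∷ τ) +_) (sumBy-insertions x τ (f ∘ (t ∷_))))

sumBy-insertions-sumCuts : ∀ x ρ Φ →
  sumBy (insertions x ρ) (λ τ → sumCuts τ Φ) ≡
  sumCuts ρ (λ α β → sumBy (insertions x α) (λ a → Φ a β) + sumBy (insertions x β) (Φ α))
sumBy-insertions-sumCuts x []      Φ = rearrange (Φ [] (x ∷ [])) (Φ (x ∷ []) [])
  where
  rearrange : ∀ a b → a + b + 0 ≡ b + 0 + (a + 0)
  rearrange = solve-∀
sumBy-insertions-sumCuts x (t ∷ ρ) Φ =
  trans expandˡ (trans (rearrange (Φ [] (x ∷ t ∷ ρ)) (Φ (x ∷ []) (t ∷ ρ)) _ _ _) (sym expandʳ))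
  where
  xtLeft emptyLeft tLeft : ℕ
  xtLeft    = sumCuts ρ (λ a b → Φ (x ∷ t ∷ a) b)
  emptyLeft = sumBy (insertions x ρ) (λ τ → Φ [] (t ∷ τ))
  tLeft     = sumCuts ρ (λ α β → sumBy (insertions x α) (λ a → Φ (t ∷ a) β) +
                                   sumBy (insertions x β) (Φ (t ∷ α)))
  expandˡ : sumBy (insertions x (t ∷ ρ)) (λ τ → sumCuts τ Φ) ≡
            (Φ [] (x ∷ t ∷ ρ) + (Φ (x ∷ []) (t ∷ ρ) + xtLeft)) + (emptyLeft + tLeft)
  expandˡ = trans (sumBy-insertions-∷ x t ρ (λ τ → sumCuts τ Φ))
    (cong (sumCuts (x ∷ t ∷ ρ) Φ +_)
      (trans (sumBy-+ (insertions x ρ) (λ τ → Φ [] (t ∷ τ)) _)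
             (cong (emptyLeft +_) (sumBy-insertions-sumCuts x ρ (λ a → Φ (t ∷ a))))))
  expandʳ : sumCuts (t ∷ ρ) (λ α β → sumBy (insertions x α) (λ a → Φ a β) + sumBy (insertions x β) (Φ α)) ≡
            (Φ (x ∷ []) (t ∷ ρ) + 0 + (Φ [] (x ∷ t ∷ ρ) + emptyLeft)) + (xtLeft + tLeft)
  expandʳ = cong₂ _+_
    (cong (Φ (x ∷ []) (t ∷ ρ) + 0 +_) (sumBy-insertions-∷ x t ρ (Φ [])))
    (trans (sumCuts-cong ρ (λ a b →
              trans (cong (_+ sumBy (insertions x b) (Φ (t ∷ a))) (sumBy-insertions-∷ x t a (λ a′ → Φ a′ b)))
                    (+-assoc (Φ (x ∷ t ∷ a) b) _ _)))
           (sumCuts-+ ρ (λ a b → Φ (x ∷ t ∷ a) b) _))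
  rearrange : ∀ a b c d e → (a + (b + c)) + (d + e) ≡ (b + 0 + (a + d)) + (c + e)
  rearrange = solve-∀

sumInterleavings : List A → (List A → List A → ℕ) → ℕ
sumInterleavings []       Φ = Φ [] []
sumInterleavings (x ∷ xs) Φ =
  sumInterleavings xs (λ l r → Φ (x ∷ l) r) + sumInterleavings xs (λ l r → Φ l (x ∷ r))

sumInterleavings-cong : ∀ (xs : List A) {Φ Ψ} → (∀ {l r} → Interleaving l r xs → Φ l r ≡ Ψ l r) →
                        sumInterleavings xs Φ ≡ sumInterleavings xs Ψ
sumInterleavings-cong []       Φ≗Ψ = Φ≗Ψ []
sumInterleavings-cong (x ∷ xs) Φ≗Ψ = cong₂ _+_ (sumInterleavings-cong xs (Φ≗Ψ ∘ consˡ))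
                                                (sumInterleavings-cong xs (Φ≗Ψ ∘ consʳ))

sumInterleavings-+ : ∀ (xs : List A) Φ Ψ →
  sumInterleavings xs (λ l r → Φ l r + Ψ l r) ≡ sumInterleavings xs Φ + sumInterleavings xs Ψ
sumInterleavings-+ []       Φ Ψ = refl
sumInterleavings-+ (x ∷ xs) Φ Ψ =
  trans (cong₂ _+_ (sumInterleavings-+ xs _ _) (sumInterleavings-+ xs _ _))
        (+-interchange (sumInterleavings xs (λ l r → Φ (x ∷ l) r)) _ _ _)

sumBy-permutations-sumCuts : ∀ L Φ →
  sumBy (permutations L) (λ τ → sumCuts τ Φ) ≡
  sumInterleavings L (λ A B → sumBy (permutations A) (λ α → sumBy (permutations B) (Φ α)))
sumBy-permutations-sumCuts []      Φ = cong (_+ 0) (sym (+-identityʳ (Φ [] [])))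
sumBy-permutations-sumCuts (x ∷ L) Φ = begin
  sumBy (permutations (x ∷ L)) (λ τ → sumCuts τ Φ)
    ≡⟨ sumBy-permutations-∷ x L _ ⟩
  sumBy (permutations L) (λ ρ → sumBy (insertions x ρ) (λ τ → sumCuts τ Φ))
    ≡⟨ sumBy-cong (permutations L) (λ ρ → sumBy-insertions-sumCuts x ρ Φ) ⟩
  sumBy (permutations L) (λ ρ → sumCuts ρ (λ α β → insertedLeft α β + insertedRight α β))
    ≡⟨ sumBy-permutations-sumCuts L _ ⟩
  sumInterleavings L (λ A B → sumBy (permutations A) (λ α → sumBy (permutations B) (λ β →
                                insertedLeft α β + insertedRight α β)))
    ≡⟨ sumInterleavings-cong L (λ {A} {B} _ →
         trans (sumBy-cong (permutations A) (λ α → sumBy-+ (permutations B) _ _))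
               (sumBy-+ (permutations A) _ _)) ⟩
  sumInterleavings L (λ A B → left A B + right A B)
    ≡⟨ sumInterleavings-+ L left right ⟩
  sumInterleavings L left + sumInterleavings L right
    ≡⟨ cong₂ _+_ (sumInterleavings-cong L (λ {A} {B} _ → left≡ A B))
                 (sumInterleavings-cong L (λ {A} {B} _ → right≡ A B)) ⟩
  sumInterleavings (x ∷ L) (λ A B → sumBy (permutations A) (λ α → sumBy (permutations B) (Φ α))) ∎
  where
  open ≡-Reasoning
  insertedLeft insertedRight : List ℕ → List ℕ → ℕ
  insertedLeft  α β = sumBy (insertions x α) (λ a → Φ a β)
  insertedRight α β = sumBy (insertions x β) (Φ α)
  left right : List ℕ → List ℕ → ℕ
  left  A B = sumBy (permutations A) (λ α → sumBy (permutations B) (insertedLeft α))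
  right A B = sumBy (permutations A) (λ α → sumBy (permutations B) (insertedRight α))
  left≡ : ∀ A B → left A B ≡ sumBy (permutations (x ∷ A)) (λ α → sumBy (permutations B) (Φ α))
  left≡ A B = trans (sumBy-cong (permutations A) (λ α → sumBy-comm (permutations B) (insertions x α) _))
                    (sym (sumBy-permutations-∷ x A _))
  right≡ : ∀ A B → right A B ≡ sumBy (permutations A) (λ α → sumBy (permutations (x ∷ B)) (Φ α))
  right≡ A B = sumBy-cong (permutations A) (λ α → sym (sumBy-permutations-∷ x B _))

<ᵇ-true : ∀ {m n} → m < n → (m <ᵇ n) ≡ true
<ᵇ-true m<n = Equivalence.to T-≡ (<⇒<ᵇ m<n)

<ᵇ-false : ∀ {m n} → n ≤ m → (m <ᵇ n) ≡ false
<ᵇ-false {m}     {zero}  _         = refl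
<ᵇ-false {suc m} {suc n} (s≤s n≤m) = <ᵇ-false n≤m

<ᵇ-asym : ∀ m n → (m <ᵇ n) ≡ true → (n <ᵇ m) ≡ false
<ᵇ-asym zero    (suc n) _ = refl
<ᵇ-asym (suc m) (suc n) e = <ᵇ-asym m n e

fromBool : Bool → ℕ
fromBool false = 0
fromBool true  = 1

fromBool≤1 : ∀ b → fromBool b ≤ 1
fromBool≤1 false = z≤n
fromBool≤1 true  = s≤s z≤n

isZero : ℕ → ℕ
isZero zero    = 1
isZero (suc _) = 0

isZero-+ : ∀ m n → isZero (m + n) ≡ isZero m * isZero n
isZero-+ zero    n = sym (+-identityʳ (isZero n))
isZero-+ (suc m) n = refl

ddAt : ℕ∞ → ℕ → ℕ → ℕ
ddAt p x z = if (p >∞ fin x) ∧ (z <ᵇ x) then 1 else 0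

ddFrom : ℕ∞ → List ℕ → ℕ
ddFrom p []          = 0
ddFrom p (x ∷ [])    = 0
ddFrom p (x ∷ z ∷ r) = ddAt p x z + ddFrom (fin x) (z ∷ r)

ddTriples≡ddFrom : ∀ p σ → ddTriples (p ∷ map fin σ ++ [ ∞ ]) ≡ ddFrom p σ
ddTriples≡ddFrom p []          = refl
ddTriples≡ddFrom p (x ∷ [])    rewrite ∧-zeroʳ (p >∞ fin x) = refl
ddTriples≡ddFrom p (x ∷ z ∷ r) = cong (ddAt p x z +_) (ddTriples≡ddFrom (fin x) (z ∷ r))

dd≡ddFrom∞ : ∀ σ → dd σ ≡ ddFrom ∞ σ
dd≡ddFrom∞ = ddTriples≡ddFrom ∞

ddFrom-fin : ∀ {m} β → All (_< m) β → ddFrom (fin m) β ≡ ddFrom ∞ β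
ddFrom-fin []          _           = refl
ddFrom-fin (b ∷ [])    _           = refl
ddFrom-fin (b ∷ c ∷ r) (b<m ∷ _) rewrite <ᵇ-true b<m = refl

ddFrom-++-max : ∀ p {m} a α β → All (_< m) (a ∷ α) → All (_< m) β →
                ddFrom p ((a ∷ α) ++ m ∷ β) ≡ ddFrom p (a ∷ α) + ddFrom ∞ β
ddFrom-++-max p a []       []       (a<m ∷ _) _
  rewrite <ᵇ-false (<⇒≤ a<m) | ∧-zeroʳ (p >∞ fin a) = refl
ddFrom-++-max p a []       (b ∷ β) (a<m ∷ _) β<m
  rewrite <ᵇ-false (<⇒≤ a<m) | ∧-zeroʳ (p >∞ fin a) = ddFrom-fin (b ∷ β) β<m
ddFrom-++-max p a (a′ ∷ α) β (_ ∷ α<m) β<m =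
  trans (cong (ddAt p a a′ +_) (ddFrom-++-max (fin a) a′ α β α<m β<m)) (sym (+-assoc (ddAt p a a′) _ _))

dd-++-max : ∀ {m} a α β → All (_< m) (a ∷ α) → All (_< m) β → dd ((a ∷ α) ++ m ∷ β) ≡ dd (a ∷ α) + dd β
dd-++-max {m} a α β α<m β<m = trans (dd≡ddFrom∞ ((a ∷ α) ++ m ∷ β)) (trans (ddFrom-++-max ∞ a α β α<m β<m)
  (sym (cong₂ _+_ (dd≡ddFrom∞ (a ∷ α)) (dd≡ddFrom∞ β))))

dd-max-∷ : ∀ {m} b β → All (_< m) (b ∷ β) → dd (m ∷ b ∷ β) ≡ suc (dd (b ∷ β))
dd-max-∷ {m} b β β<m@(b<m ∷ _) = trans (dd≡ddFrom∞ (m ∷ b ∷ β))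
  (trans (cong (λ c → (if c then 1 else 0) + ddFrom (fin m) (b ∷ β)) (<ᵇ-true b<m))
         (cong suc (trans (ddFrom-fin (b ∷ β) β<m) (sym (dd≡ddFrom∞ (b ∷ β))))))

des-++-max : ∀ {m} a α β → All (_< m) (a ∷ α) → des ((a ∷ α) ++ m ∷ β) ≡ des (a ∷ α) + des (m ∷ β)
des-++-max a []       β (a<m ∷ _) rewrite <ᵇ-false (<⇒≤ a<m) = refl
des-++-max a (a′ ∷ α) β (_ ∷ α<m) =
  trans (cong (_ +_) (des-++-max a′ α β α<m)) (sym (+-assoc (if a′ <ᵇ a then 1 else 0) _ _))

des-max-∷ : ∀ {m} b β → All (_< m) (b ∷ β) → des (m ∷ b ∷ β) ≡ suc (des (b ∷ β))
des-max-∷ b β (b<m ∷ _) rewrite <ᵇ-true b<m = refl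

lastAscent-++-∷∷ : ∀ x α m b β → lastAscent (x ∷ α ++ m ∷ b ∷ β) ≡ lastAscent (m ∷ b ∷ β)
lastAscent-++-∷∷ x []            m b β = refl
lastAscent-++-∷∷ x (a ∷ [])      m b β = refl
lastAscent-++-∷∷ x (a ∷ a′ ∷ α) m b β = lastAscent-++-∷∷ a (a′ ∷ α) m b β

lastAscent-max-∷ : ∀ {m} b β → All (_< m) (b ∷ β) → lastAscent (m ∷ b ∷ β) ≡ lastAscent (b ∷ β)
lastAscent-max-∷ b []      (b<m ∷ _) = <ᵇ-false (<⇒≤ b<m)
lastAscent-max-∷ b (c ∷ β) _         = refl

lastAscent-++-max : ∀ {m} x α → All (_< m) (x ∷ α) → lastAscent (x ∷ α ++ [ m ]) ≡ true
lastAscent-++-max x []            (x<m ∷ _)     = <ᵇ-true x<m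
lastAscent-++-max x (a ∷ [])      (_ ∷ a<m ∷ _) = <ᵇ-true a<m
lastAscent-++-max x (a ∷ a′ ∷ α) (_ ∷ α<m)     = lastAscent-++-max a (a′ ∷ α) α<m

countBelow : ℕ → List ℕ → ℕ
countBelow x xs = sumBy xs (λ z → if z <ᵇ x then 1 else 0)

crossInversions : List ℕ → List ℕ → ℕ
crossInversions α γ = sumBy α (λ a → countBelow a γ)

countBelow-max : ∀ {x} β → All (_< x) β → countBelow x β ≡ length β
countBelow-max []      _           = refl
countBelow-max (b ∷ β) (b<x ∷ β<x) rewrite <ᵇ-true b<x = cong suc (countBelow-max β β<x)

crossInversions-∷-max : ∀ {m} α β → All (_< m) α → crossInversions α (m ∷ β) ≡ crossInversions α β
crossInversions-∷-max []      β _           = refl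
crossInversions-∷-max (a ∷ α) β (a<m ∷ α<m) rewrite <ᵇ-false (<⇒≤ a<m) =
  cong (countBelow a β +_) (crossInversions-∷-max α β α<m)

crossInversions-↭ : ∀ {α α′ β β′} → α ↭ α′ → β ↭ β′ → crossInversions α β ≡ crossInversions α′ β′
crossInversions-↭ {α′ = α′} α↭ β↭ =
  trans (sumBy-↭ _ α↭) (sumBy-cong α′ (λ a → sumBy-↭ _ β↭))

inv-++ : ∀ α γ → inv (α ++ γ) ≡ inv α + inv γ + crossInversions α γ
inv-++ []      γ = sym (+-identityʳ (inv γ))
inv-++ (a ∷ α) γ =
  trans (cong₂ _+_ (sumBy-++ α γ _) (inv-++ α γ))
        (rearrange (countBelow a α) (countBelow a γ) (inv α) (inv γ) (crossInversions α γ))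
  where
  rearrange : ∀ a b c d e → a + b + (c + d + e) ≡ a + c + d + (b + e)
  rearrange = solve-∀

inv-++-max : ∀ {m} α β → All (_< m) α → All (_< m) β →
             inv (α ++ m ∷ β) ≡ inv α + (length β + inv β) + crossInversions α β
inv-++-max α β α<m β<m = trans (inv-++ α (_ ∷ β))
  (cong₂ (λ c x → inv α + (c + inv β) + x) (countBelow-max β β<m) (crossInversions-∷-max α β α<m))

≤⌊/2⌋ : ∀ {d m} → 2 * d ≤ m → d ≤ ⌊ m /2⌋
≤⌊/2⌋ {d} 2d≤m = subst (_≤ _) (sym (n≡⌊n+n/2⌋ d))
  (⌊n/2⌋-mono (≤-trans (≤-reflexive (cong (d +_) (sym (+-identityʳ d)))) 2d≤m))

-- Without double descents, every descent σᵢ > σᵢ₊₁ follows an ascent σᵢ₋₁ < σᵢ (where σ₀ = p).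
des-bound-ddFrom : ∀ p x r → ddFrom p (x ∷ r) ≡ 0 →
  2 * des (x ∷ r) + fromBool (p >∞ fin x) + fromBool (lastAscent (x ∷ r)) ≤ length (x ∷ r)
des-bound-ddFrom p x []          _ = ≤-trans (≤-reflexive (+-identityʳ _)) (fromBool≤1 (p >∞ fin x))
des-bound-ddFrom p x (z ∷ [])    h with z <ᵇ x in z<x | p >∞ fin x
des-bound-ddFrom p x (z ∷ [])    () | true  | true
... | true  | false rewrite <ᵇ-asym z x z<x = ≤-refl
... | false | b = +-mono-≤ (fromBool≤1 b) (fromBool≤1 (x <ᵇ z))
des-bound-ddFrom p x (z ∷ u ∷ r) h =
  extend (z <ᵇ x) (p >∞ fin x) h (des-bound-ddFrom (fin x) z (u ∷ r) (m+n≡0⇒n≡0 (ddAt p x z) h))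
  where
  extend : ∀ a b {D d l n} → (if b ∧ a then 1 else 0) + D ≡ 0 → 2 * d + fromBool a + l ≤ n →
           2 * ((if a then 1 else 0) + d) + fromBool b + l ≤ suc n
  extend true  true  ()
  extend true  false {d = d} {l} _ ih = ≤-trans (≤-reflexive (descent d l)) (s≤s ih)
    where descent : ∀ d l → 2 * (1 + d) + 0 + l ≡ suc (2 * d + 1 + l)
          descent = solve-∀
  extend false b {d = d} {l} _ ih =
    ≤-trans (+-monoˡ-≤ l (+-monoʳ-≤ (2 * d) (fromBool≤1 b))) (≤-trans (≤-reflexive (ascent d l)) (s≤s ih))
    where ascent : ∀ d l → 2 * (0 + d) + 1 + l ≡ suc (2 * d + 0 + l)
          ascent = solve-∀

des-bound-dd : ∀ {m} σ → dd σ ≡ 0 → length σ ≡ suc m → des σ ≤ ⌊ m /2⌋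
des-bound-dd (x ∷ r) dd≡0 len = ≤⌊/2⌋ (≤-pred (≤-trans (≤-reflexive (+-comm 1 (2 * des (x ∷ r))))
  (≤-trans (m≤m+n _ _)
    (≤-trans (des-bound-ddFrom ∞ x r (trans (sym (dd≡ddFrom∞ (x ∷ r))) dd≡0)) (≤-reflexive len)))))

des-bound-dd-lastAscent : ∀ {m} σ → dd σ ≡ 0 → lastAscent σ ≡ true → length σ ≡ suc m →
                          suc (des σ) ≤ ⌊ suc m /2⌋
des-bound-dd-lastAscent (x ∷ r) dd≡0 asc len = ≤⌊/2⌋ (≤-trans (≤-reflexive (double-suc (des (x ∷ r))))
  (≤-trans (subst (λ b → 2 * des (x ∷ r) + 1 + fromBool b ≤ _) asc
                  (des-bound-ddFrom ∞ x r (trans (sym (dd≡ddFrom∞ (x ∷ r))) dd≡0)))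
           (≤-reflexive len)))
  where
  double-suc : ∀ d → 2 * suc d ≡ 2 * d + 1 + 1
  double-suc = solve-∀

sumBy-permutations-∷-split : ∀ m L (f : List ℕ → ℕ) →
  sumBy (permutations (m ∷ L)) f ≡
  sumInterleavings L (λ A B → sumBy (permutations A) (λ α → sumBy (permutations B) (λ β → f (α ++ m ∷ β))))
sumBy-permutations-∷-split m L f =
  trans (sumBy-permutations-∷ m L f)
    (trans (sumBy-cong (permutations L) (λ τ → sumBy-insertions m τ f))
           (sumBy-permutations-sumCuts L (λ a b → f (a ++ m ∷ b))))

All-interleaving : ∀ {P : A → Set} {l r xs} → Interleaving l r xs → All P xs → All P l × All P r
All-interleaving {l = l} s pxs = Allₚ.++⁻ l (↭ₚ.All-resp-↭ (toPermutation s) pxs)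

AllPairs-interleaving : ∀ {R : A → A → Set} {l r xs} → Interleaving l r xs →
                        AllPairs R xs → AllPairs R l × AllPairs R r
AllPairs-interleaving []         []           = [] , []
AllPairs-interleaving (consˡ s) (px ∷ pxs) =
  (proj₁ (All-interleaving s px) ∷ proj₁ (AllPairs-interleaving s pxs)) , proj₂ (AllPairs-interleaving s pxs)
AllPairs-interleaving (consʳ s) (px ∷ pxs) =
  proj₁ (AllPairs-interleaving s pxs) , (proj₂ (All-interleaving s px) ∷ proj₂ (AllPairs-interleaving s pxs))

module Weights (y q : ℕ) where

  weightOf : ℕ → ℕ → ℕ → ℕ
  weightOf d i e = isZero d * (q ^ i * y ^ e)

  weight : List ℕ → ℕ
  weight σ = weightOf (dd σ) (inv σ) (des σ)

  -- σ ∈ 𝔇̃ₙ,ₖ is counted with y ^ k where k = des σ + 1.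
  weight~ : List ℕ → ℕ
  weight~ σ = fromBool (lastAscent σ) * (y * weight σ)

  weight-stats : ∀ σ {d i e} → dd σ ≡ d → inv σ ≡ i → des σ ≡ e → weight σ ≡ weightOf d i e
  weight-stats σ refl refl refl = refl

  weightOf-split : ∀ d₁ d₂ i₁ i₂ l c e₁ e₂ →
    weightOf (d₁ + d₂) (i₁ + (l + i₂) + c) (e₁ + suc e₂) ≡ y * q ^ (c + l) * weightOf d₁ i₁ e₁ * weightOf d₂ i₂ e₂
  weightOf-split d₁ d₂ i₁ i₂ l c e₁ e₂
    rewrite isZero-+ d₁ d₂ | ^-distribˡ-+-* q (i₁ + (l + i₂)) c | ^-distribˡ-+-* q i₁ (l + i₂)
          | ^-distribˡ-+-* q l i₂ | ^-distribˡ-+-* y e₁ (suc e₂) | ^-distribˡ-+-* q c l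
    = rearrange y (isZero d₁) (isZero d₂) (q ^ i₁) (q ^ l) (q ^ i₂) (q ^ c) (y ^ e₁) (y ^ e₂)
    where
    rearrange : ∀ y D₁ D₂ Q₁ L Q₂ C Y₁ Y₂ →
      D₁ * D₂ * (Q₁ * (L * Q₂) * C * (Y₁ * (y * Y₂))) ≡ y * (C * L) * (D₁ * (Q₁ * Y₁)) * (D₂ * (Q₂ * Y₂))
    rearrange = solve-∀

  weight-++-max-[] : ∀ {m} α → All (_< m) α → weight (α ++ [ m ]) ≡ weight α
  weight-++-max-[] []      _   = refl
  weight-++-max-[] {m} (a ∷ α) α<m = weight-stats ((a ∷ α) ++ [ m ])
    (trans (dd-++-max a α [] α<m []) (+-identityʳ _))
    (trans (inv-++-max (a ∷ α) [] α<m [])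
           (trans (cong (inv (a ∷ α) + 0 +_) (sumBy-zero (a ∷ α))) (trans (+-identityʳ _) (+-identityʳ _))))
    (trans (des-++-max a α [] α<m) (+-identityʳ _))

  weight-max-∷ : ∀ {m} b β → All (_< m) (b ∷ β) → weight (m ∷ b ∷ β) ≡ 0
  weight-max-∷ {m} b β β<m = cong (λ d → weightOf d (inv (m ∷ b ∷ β)) (des (m ∷ b ∷ β))) (dd-max-∷ b β β<m)

  weight-++-max : ∀ {m} a α b β → All (_< m) (a ∷ α) → All (_< m) (b ∷ β) →
    weight ((a ∷ α) ++ m ∷ b ∷ β) ≡
    y * q ^ (crossInversions (a ∷ α) (b ∷ β) + length (b ∷ β)) * weight (a ∷ α) * weight (b ∷ β)
  weight-++-max {m} a α b β α<m β<m = trans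
    (weight-stats ((a ∷ α) ++ m ∷ b ∷ β) (dd-++-max a α (b ∷ β) α<m β<m) (inv-++-max (a ∷ α) (b ∷ β) α<m β<m)
                  (trans (des-++-max a α (b ∷ β) α<m) (cong (des (a ∷ α) +_) (des-max-∷ b β β<m))))
    (weightOf-split (dd (a ∷ α)) (dd (b ∷ β)) (inv (a ∷ α)) (inv (b ∷ β)) (length (b ∷ β))
                    (crossInversions (a ∷ α) (b ∷ β)) (des (a ∷ α)) (des (b ∷ β)))

  weight~-++-max-[] : ∀ {m} a α → All (_< m) (a ∷ α) → weight~ ((a ∷ α) ++ [ m ]) ≡ y * weight (a ∷ α)
  weight~-++-max-[] a α α<m = trans
    (cong₂ (λ b w → fromBool b * (y * w)) (lastAscent-++-max a α α<m) (weight-++-max-[] (a ∷ α) α<m))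
    (+-identityʳ _)

  weight~-max-∷ : ∀ {m} b β → All (_< m) (b ∷ β) → weight~ (m ∷ b ∷ β) ≡ 0
  weight~-max-∷ {m} b β β<m = trans (cong (λ w → asc * (y * w)) (weight-max-∷ b β β<m))
                                    (trans (cong (asc *_) (*-zeroʳ y)) (*-zeroʳ asc))
    where
    asc : ℕ
    asc = fromBool (lastAscent (m ∷ b ∷ β))

  weight~-++-max : ∀ {m} a α b β → All (_< m) (a ∷ α) → All (_< m) (b ∷ β) →
    weight~ ((a ∷ α) ++ m ∷ b ∷ β) ≡
    y * q ^ (crossInversions (a ∷ α) (b ∷ β) + length (b ∷ β)) * weight (a ∷ α) * weight~ (b ∷ β)
  weight~-++-max {m} a α b β α<m β<m = trans
    (cong₂ (λ b w → fromBool b * (y * w))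
           (trans (lastAscent-++-∷∷ a α m b β) (lastAscent-max-∷ b β β<m)) (weight-++-max a α b β α<m β<m))
    (rearrange (fromBool (lastAscent (b ∷ β))) y (y * q ^ (crossInversions (a ∷ α) (b ∷ β) + length (b ∷ β)))
               (weight (a ∷ α)) (weight (b ∷ β)))
    where
    rearrange : ∀ B y K W V → B * (y * (K * W * V)) ≡ K * W * (B * (y * V))
    rearrange = solve-∀

  weightSum weightSum~ : List ℕ → ℕ
  weightSum  L = sumBy (permutations L) weight
  weightSum~ L = sumBy (permutations L) weight~

  -- The maximum m of α ++ m ∷ β changes nothing at the end, is a double descent at the front (β ≠ []),
  -- and otherwise adds one descent and |B| inversions.
  gluedWeight : List ℕ → List ℕ → ℕ
  gluedWeight A       []      = weightSum A
  gluedWeight []      (_ ∷ _) = 0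
  gluedWeight (a ∷ A) (b ∷ B) = y * q ^ length (b ∷ B) * weightSum (a ∷ A) * weightSum (b ∷ B)

  gluedWeight~ : List ℕ → List ℕ → ℕ
  gluedWeight~ []      []      = 0
  gluedWeight~ (a ∷ A) []      = y * weightSum (a ∷ A)
  gluedWeight~ []      (_ ∷ _) = 0
  gluedWeight~ (a ∷ A) (b ∷ B) = y * q ^ length (b ∷ B) * weightSum (a ∷ A) * weightSum~ (b ∷ B)

  sumBy-glue-∷∷ : ∀ (f g : List ℕ → ℕ) {m} a A b B → All (_< m) (a ∷ A) → All (_< m) (b ∷ B) →
    (∀ a′ α b′ β → All (_< m) (a′ ∷ α) → All (_< m) (b′ ∷ β) →
       f ((a′ ∷ α) ++ m ∷ b′ ∷ β) ≡
       y * q ^ (crossInversions (a′ ∷ α) (b′ ∷ β) + length (b′ ∷ β)) * weight (a′ ∷ α) * g (b′ ∷ β)) →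
    sumBy (permutations (a ∷ A)) (λ α → sumBy (permutations (b ∷ B)) (λ β → f (α ++ m ∷ β))) ≡
    q ^ crossInversions (a ∷ A) (b ∷ B) *
      (y * q ^ length (b ∷ B) * weightSum (a ∷ A) * sumBy (permutations (b ∷ B)) g)
  sumBy-glue-∷∷ f g {m} a A b B A<m B<m f-glue = begin
    sumBy (permutations (a ∷ A)) (λ α → sumBy (permutations (b ∷ B)) (λ β → f (α ++ m ∷ β)))
      ≡⟨ sumBy-permutations-cong (a ∷ A) (λ α↭ → sumBy-permutations-cong (b ∷ B) (λ β↭ → glue α↭ β↭)) ⟩
    sumBy (permutations (a ∷ A)) (λ α → sumBy (permutations (b ∷ B)) (λ β → K * weight α * g β))
      ≡⟨ sumBy-* (permutations (a ∷ A)) (permutations (b ∷ B)) (λ α → K * weight α) g ⟩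
    sumBy (permutations (a ∷ A)) (λ α → K * weight α) * sumBy (permutations (b ∷ B)) g
      ≡⟨ cong (_* sumBy (permutations (b ∷ B)) g) (sumBy-*ˡ (permutations (a ∷ A)) K weight) ⟩
    K * weightSum (a ∷ A) * sumBy (permutations (b ∷ B)) g
      ≡⟨ cong (λ z → y * z * weightSum (a ∷ A) * sumBy (permutations (b ∷ B)) g) (^-distribˡ-+-* q c l) ⟩
    y * (q ^ c * q ^ l) * weightSum (a ∷ A) * sumBy (permutations (b ∷ B)) g
      ≡⟨ rearrange y (q ^ c) (q ^ l) (weightSum (a ∷ A)) (sumBy (permutations (b ∷ B)) g) ⟩
    q ^ c * (y * q ^ l * weightSum (a ∷ A) * sumBy (permutations (b ∷ B)) g) ∎
    where
    open ≡-Reasoning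
    c l K : ℕ
    c = crossInversions (a ∷ A) (b ∷ B)
    l = length (b ∷ B)
    K = y * q ^ (c + l)
    glue : ∀ {α β} → α ↭ a ∷ A → β ↭ b ∷ B → f (α ++ m ∷ β) ≡ K * weight α * g β
    glue {[]}      α↭ _ = ⊥-elim (¬[]↭x∷xs α↭)
    glue {_ ∷ _} {[]} _ β↭ = ⊥-elim (¬[]↭x∷xs β↭)
    glue {a′ ∷ α} {b′ ∷ β} α↭ β↭ = trans
      (f-glue a′ α b′ β (All-↭ α↭ A<m) (All-↭ β↭ B<m))
      (cong (λ e → y * q ^ e * weight (a′ ∷ α) * g (b′ ∷ β))
            (cong₂ _+_ (crossInversions-↭ α↭ β↭) (↭ₚ.↭-length β↭)))
    rearrange : ∀ y C L W V → y * (C * L) * W * V ≡ C * (y * L * W * V)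
    rearrange = solve-∀

  sumBy-glue-weight : ∀ {m} A B → All (_< m) A → All (_< m) B →
    sumBy (permutations A) (λ α → sumBy (permutations B) (λ β → weight (α ++ m ∷ β))) ≡
    q ^ crossInversions A B * gluedWeight A B
  sumBy-glue-weight A []       A<m _ =
    trans (sumBy-permutations-cong A (λ α↭ → trans (+-identityʳ _) (weight-++-max-[] _ (All-↭ α↭ A<m))))
          (sym (trans (cong (λ c → q ^ c * weightSum A) (sumBy-zero A)) (+-identityʳ _)))
  sumBy-glue-weight []      (b ∷ B) _ B<m = trans (+-identityʳ _) (sumBy-permutations-≡0 (b ∷ B) top)
    where
    top : ∀ {β} → β ↭ b ∷ B → weight (_ ∷ β) ≡ 0
    top {[]}     β↭ = ⊥-elim (¬[]↭x∷xs β↭)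
    top {b′ ∷ β} β↭ = weight-max-∷ b′ β (All-↭ β↭ B<m)
  sumBy-glue-weight (a ∷ A) (b ∷ B) A<m B<m = sumBy-glue-∷∷ weight weight a A b B A<m B<m weight-++-max

  sumBy-glue-weight~ : ∀ {m} A B → All (_< m) A → All (_< m) B →
    sumBy (permutations A) (λ α → sumBy (permutations B) (λ β → weight~ (α ++ m ∷ β))) ≡
    q ^ crossInversions A B * gluedWeight~ A B
  sumBy-glue-weight~ []      []      _   _ = refl
  sumBy-glue-weight~ (a ∷ A) []      A<m _ =
    trans (sumBy-permutations-cong (a ∷ A) bottom)
          (trans (sumBy-*ˡ (permutations (a ∷ A)) y weight)
                 (sym (trans (cong (λ c → q ^ c * (y * weightSum (a ∷ A))) (sumBy-zero (a ∷ A))) (+-identityʳ _))))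
    where
    bottom : ∀ {α} → α ↭ a ∷ A → weight~ (α ++ _ ∷ []) + 0 ≡ y * weight α
    bottom {[]}     α↭ = ⊥-elim (¬[]↭x∷xs α↭)
    bottom {a′ ∷ α} α↭ = trans (+-identityʳ _) (weight~-++-max-[] a′ α (All-↭ α↭ A<m))
  sumBy-glue-weight~ []      (b ∷ B) _ B<m = trans (+-identityʳ _) (sumBy-permutations-≡0 (b ∷ B) top)
    where
    top : ∀ {β} → β ↭ b ∷ B → weight~ (_ ∷ β) ≡ 0
    top {[]}     β↭ = ⊥-elim (¬[]↭x∷xs β↭)
    top {b′ ∷ β} β↭ = weight~-max-∷ b′ β (All-↭ β↭ B<m)
  sumBy-glue-weight~ (a ∷ A) (b ∷ B) A<m B<m = sumBy-glue-∷∷ weight~ weight~ a A b B A<m B<m weight~-++-max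

  weightSum-max-∷ : ∀ {m} L → All (_< m) L →
    weightSum (m ∷ L) ≡ sumInterleavings L (λ A B → q ^ crossInversions A B * gluedWeight A B)
  weightSum-max-∷ {m} L L<m = trans (sumBy-permutations-∷-split m L weight) (sumInterleavings-cong L (λ s →
    sumBy-glue-weight _ _ (proj₁ (All-interleaving s L<m)) (proj₂ (All-interleaving s L<m))))

  weightSum~-max-∷ : ∀ {m} L → All (_< m) L →
    weightSum~ (m ∷ L) ≡ sumInterleavings L (λ A B → q ^ crossInversions A B * gluedWeight~ A B)
  weightSum~-max-∷ {m} L L<m = trans (sumBy-permutations-∷-split m L weight~) (sumInterleavings-cong L (λ s →
    sumBy-glue-weight~ _ _ (proj₁ (All-interleaving s L<m)) (proj₂ (All-interleaving s L<m))))

module Gaussian (q : ℕ) where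

  gaussian : ℕ → ℕ → ℕ
  gaussian n       zero    = 1
  gaussian zero    (suc k) = 0
  gaussian (suc n) (suc k) = q ^ suc k * gaussian n (suc k) + gaussian n k

  gaussian-above : ∀ n k → n < k → gaussian n k ≡ 0
  gaussian-above zero    (suc k) _         = refl
  gaussian-above (suc n) (suc k) (s≤s n<k)
    rewrite gaussian-above n (suc k) (m<n⇒m<1+n n<k) | gaussian-above n k n<k =
    trans (+-identityʳ _) (*-zeroʳ (q ^ suc k))

  gaussian-diag : ∀ n → gaussian n n ≡ 1
  gaussian-diag zero    = refl
  gaussian-diag (suc n) rewrite gaussian-above n (suc n) ≤-refl | gaussian-diag n | *-zeroʳ (q ^ suc n) = refl

  gaussian-convolution : ∀ k (φ : ℕ → ℕ → ℕ) →
    sumBelow (suc k) (λ i → gaussian k i * (q ^ i * φ (suc (k ∸ i)) i)) +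
    sumBelow (suc k) (λ i → gaussian k i * φ (k ∸ i) (suc i)) ≡
    sumBelow (suc (suc k)) (λ i → gaussian (suc k) i * φ (suc k ∸ i) i)
  gaussian-convolution k φ = begin
    (1 * (1 * φ (suc k) 0) + leftShifted) + right
      ≡⟨ cong (λ z → z + leftShifted + right) (trans (*-identityˡ _) (*-identityˡ (φ (suc k) 0))) ⟩
    φ (suc k) 0 + leftShifted + right
      ≡⟨ +-assoc (φ (suc k) 0) _ _ ⟩
    φ (suc k) 0 + (leftShifted + right)
      ≡⟨ cong (λ z → φ (suc k) 0 + (z + right)) shift ⟩
    φ (suc k) 0 + (sumBelow (suc k) lifted + right)
      ≡⟨ cong (φ (suc k) 0 +_) pascal ⟨
    φ (suc k) 0 + sumBelow (suc k) (λ j → gaussian (suc k) (suc j) * φ (k ∸ j) (suc j))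
      ≡⟨ cong (_+ sumBelow (suc k) (λ j → gaussian (suc k) (suc j) * φ (k ∸ j) (suc j))) (*-identityˡ (φ (suc k) 0)) ⟨
    sumBelow (suc (suc k)) (λ i → gaussian (suc k) i * φ (suc k ∸ i) i) ∎
    where
    open ≡-Reasoning
    leftShifted right : ℕ
    leftShifted = sumBelow k (λ j → gaussian k (suc j) * (q ^ suc j * φ (suc (k ∸ suc j)) (suc j)))
    lifted rightTerm : ℕ → ℕ
    lifted j    = q ^ suc j * gaussian k (suc j) * φ (k ∸ j) (suc j)
    rightTerm i = gaussian k i * φ (k ∸ i) (suc i)
    right = sumBelow (suc k) rightTerm
    pascal : sumBelow (suc k) (λ j → gaussian (suc k) (suc j) * φ (k ∸ j) (suc j)) ≡
             sumBelow (suc k) lifted + right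
    pascal = trans (sumBelow-cong (suc k) (λ {j} _ →
                     *-distribʳ-+ (φ (k ∸ j) (suc j)) (q ^ suc j * gaussian k (suc j)) (gaussian k j)))
                   (sumBelow-+ (suc k) lifted rightTerm)
    rearrange : ∀ G Q F → G * (Q * F) ≡ Q * G * F
    rearrange = solve-∀
    shift : leftShifted ≡ sumBelow (suc k) lifted
    shift = sym (begin
      sumBelow (suc k) lifted
        ≡⟨ sumBelow-suc k lifted ⟩
      sumBelow k lifted +
        q ^ suc k * gaussian k (suc k) * φ (k ∸ k) (suc k)
        ≡⟨ cong (λ g → sumBelow k lifted + q ^ suc k * g * φ (k ∸ k) (suc k)) (gaussian-above k (suc k) ≤-refl) ⟩
      sumBelow k lifted + q ^ suc k * 0 * φ (k ∸ k) (suc k)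
        ≡⟨ cong (λ z → sumBelow k lifted + z * φ (k ∸ k) (suc k)) (*-zeroʳ (q ^ suc k)) ⟩
      sumBelow k lifted + 0
        ≡⟨ +-identityʳ _ ⟩
      sumBelow k lifted
        ≡⟨ sumBelow-cong k (λ {j} j<k →
             trans (cong (λ i → q ^ suc j * gaussian k (suc j) * φ i (suc j)) (+-∸-assoc 1 j<k))
                   (sym (rearrange (gaussian k (suc j)) (q ^ suc j) _))) ⟩
      leftShifted ∎)

  sumInterleavings-crossInversions : ∀ L → AllPairs _>_ L → (φ : ℕ → ℕ → ℕ) →
    sumInterleavings L (λ A B → q ^ crossInversions A B * φ (length A) (length B)) ≡
    sumBelow (suc (length L)) (λ i → gaussian (length L) i * φ (length L ∸ i) i)
  sumInterleavings-crossInversions []      _              φ = sym (+-identityʳ _)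
  sumInterleavings-crossInversions (x ∷ L) (L<x ∷ L-decr) φ = begin
    sumInterleavings L (λ A B → q ^ crossInversions (x ∷ A) B * φ (suc (length A)) (length B)) +
    sumInterleavings L (λ A B → q ^ crossInversions A (x ∷ B) * φ (length A) (suc (length B)))
      ≡⟨ cong₂ _+_ (sumInterleavings-cong L x-left) (sumInterleavings-cong L x-right) ⟩
    sumInterleavings L (λ A B → q ^ crossInversions A B * (q ^ length B * φ (suc (length A)) (length B))) +
    sumInterleavings L (λ A B → q ^ crossInversions A B * φ (length A) (suc (length B)))
      ≡⟨ cong₂ _+_ (sumInterleavings-crossInversions L L-decr (λ a b → q ^ b * φ (suc a) b))
                   (sumInterleavings-crossInversions L L-decr (λ a b → φ a (suc b))) ⟩
    sumBelow (suc k) (λ i → gaussian k i * (q ^ i * φ (suc (k ∸ i)) i)) +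
    sumBelow (suc k) (λ i → gaussian k i * φ (k ∸ i) (suc i))
      ≡⟨ gaussian-convolution k φ ⟩
    sumBelow (suc (suc k)) (λ i → gaussian (suc k) i * φ (suc k ∸ i) i) ∎
    where
    open ≡-Reasoning
    k : ℕ
    k = length L
    x-left : ∀ {A B} → Interleaving A B L →
      q ^ crossInversions (x ∷ A) B * φ (suc (length A)) (length B) ≡
      q ^ crossInversions A B * (q ^ length B * φ (suc (length A)) (length B))
    x-left {A} {B} s = begin
      q ^ (countBelow x B + crossInversions A B) * φ (suc (length A)) (length B)
        ≡⟨ cong (λ c → q ^ (c + crossInversions A B) * φ (suc (length A)) (length B))
                (countBelow-max B (proj₂ (All-interleaving s L<x))) ⟩
      q ^ (length B + crossInversions A B) * φ (suc (length A)) (length B)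
        ≡⟨ cong (λ e → q ^ e * φ (suc (length A)) (length B)) (+-comm (length B) _) ⟩
      q ^ (crossInversions A B + length B) * φ (suc (length A)) (length B)
        ≡⟨ cong (_* _) (^-distribˡ-+-* q (crossInversions A B) (length B)) ⟩
      q ^ crossInversions A B * q ^ length B * φ (suc (length A)) (length B)
        ≡⟨ *-assoc (q ^ crossInversions A B) _ _ ⟩
      q ^ crossInversions A B * (q ^ length B * φ (suc (length A)) (length B)) ∎
    x-right : ∀ {A B} → Interleaving A B L →
      q ^ crossInversions A (x ∷ B) * φ (length A) (suc (length B)) ≡
      q ^ crossInversions A B * φ (length A) (suc (length B))
    x-right {A} {B} s = cong (λ c → q ^ c * φ (length A) (suc (length B)))
                             (crossInversions-∷-max A B (proj₁ (All-interleaving s L<x)))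

  ^-positive : 1 ≤ q → ∀ n → 1 ≤ q ^ n
  ^-positive 1≤q n = m^n>0 q {{>-nonZero 1≤q}} n

  gaussian-qPoch : 1 ≤ q → ∀ a b → gaussian (a + b) a * (qPoch± q a * qPoch± q b) ≡ qPoch± q (a + b)
  gaussian-qPoch 1≤q zero    b = trans (*-identityˡ _) (*-identityˡ _)
  gaussian-qPoch 1≤q (suc a) zero rewrite +-identityʳ a | gaussian-diag (suc a) =
    trans (*-identityˡ _) (*-identityʳ _)
  gaussian-qPoch 1≤q (suc a) (suc b) = begin
    (Q * G₁ + G₀) * (P a * (Q ∸ 1) * (P b * (R ∸ 1)))
      ≡⟨ distribute Q G₁ G₀ (P a) (Q ∸ 1) (P b) (R ∸ 1) ⟩
    Q * (R ∸ 1) * (G₁ * (P a * (Q ∸ 1) * P b)) + (Q ∸ 1) * (G₀ * (P a * (P b * (R ∸ 1))))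
      ≡⟨ cong₂ (λ u v → Q * (R ∸ 1) * u + (Q ∸ 1) * v) shifted (gaussian-qPoch 1≤q a (suc b)) ⟩
    Q * (R ∸ 1) * P (a + suc b) + (Q ∸ 1) * P (a + suc b)
      ≡⟨ factor Q (R ∸ 1) (Q ∸ 1) (P (a + suc b)) ⟩
    P (a + suc b) * (Q * (R ∸ 1) + (Q ∸ 1))
      ≡⟨ cong (P (a + suc b) *_) (pred-* Q R (^-positive 1≤q (suc a)) (^-positive 1≤q (suc b))) ⟩
    P (a + suc b) * (Q * R ∸ 1)
      ≡⟨ cong (λ e → P (a + suc b) * (e ∸ 1)) (^-distribˡ-+-* q (suc a) (suc b)) ⟨
    P (a + suc b) * (q ^ (suc a + suc b) ∸ 1) ∎
    where
    open ≡-Reasoning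
    P : ℕ → ℕ
    P = qPoch± q
    Q R G₁ G₀ : ℕ
    Q = q ^ suc a
    R = q ^ suc b
    G₁ = gaussian (a + suc b) (suc a)
    G₀ = gaussian (a + suc b) a
    shifted : G₁ * (P (suc a) * P b) ≡ P (a + suc b)
    shifted = subst (λ n → gaussian n (suc a) * (P (suc a) * P b) ≡ P n) (sym (+-suc a b))
                    (gaussian-qPoch 1≤q (suc a) b)
    distribute : ∀ Q G₁ G₀ Pa Q′ Pb R′ →
      (Q * G₁ + G₀) * (Pa * Q′ * (Pb * R′)) ≡ Q * R′ * (G₁ * (Pa * Q′ * Pb)) + Q′ * (G₀ * (Pa * (Pb * R′)))
    distribute = solve-∀
    factor : ∀ Q R′ Q′ P → Q * R′ * P + Q′ * P ≡ P * (Q * R′ + Q′)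
    factor = solve-∀
    pred-* : ∀ X Y → 1 ≤ X → 1 ≤ Y → X * (Y ∸ 1) + (X ∸ 1) ≡ X * Y ∸ 1
    pred-* (suc x) (suc y) _ _ = expand x y
      where expand : ∀ x y → suc x * y + x ≡ y + x * suc y
            expand = solve-∀

  qPoch-positive : 2 ≤ q → ∀ n → 1 ≤ qPoch± q n
  qPoch-positive 2≤q zero    = ≤-refl
  qPoch-positive 2≤q (suc n) = *-mono-≤ (qPoch-positive 2≤q n) (∸-monoˡ-≤ 1 (≤-trans 2≤q q≤q^[1+n]))
    where
    q≤q^[1+n] : q ≤ q ^ suc n
    q≤q^[1+n] = ≤-trans (≤-reflexive (sym (*-identityʳ q))) (*-monoʳ-≤ q (^-positive (≤-trans (s≤s z≤n) 2≤q) n))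

  -- For q ≥ 2 every factor qⁱ ∸ 1 is positive, so the truncated division in qBinom is exact.
  qBinom≡gaussian : 2 ≤ q → ∀ {n k} → k ≤ n → qBinom q n k ≡ gaussian n k
  qBinom≡gaussian 2≤q {n} {k} k≤n = begin
    qPoch± q n div denom
      ≡⟨ cong (_div denom) (trans (gaussian-qPoch 1≤q k (n ∸ k)) (cong (qPoch± q) (m+[n∸m]≡n k≤n))) ⟨
    (gaussian (k + (n ∸ k)) k * denom) div denom
      ≡⟨ cong (λ m → (gaussian m k * denom) div denom) (m+[n∸m]≡n k≤n) ⟩
    (gaussian n k * denom) div denom
      ≡⟨ *-div (gaussian n k) denom (*-mono-≤ (qPoch-positive 2≤q k) (qPoch-positive 2≤q (n ∸ k))) ⟩
    gaussian n k ∎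
    where
    open ≡-Reasoning
    1≤q : 1 ≤ q
    1≤q = ≤-trans (s≤s z≤n) 2≤q
    denom : ℕ
    denom = qPoch± q k * qPoch± q (n ∸ k)
    *-div : ∀ m d → 1 ≤ d → (m * d) div d ≡ m
    *-div m (suc d) _ = m*n/n≡m m (suc d)

downFrom-decreasing : ∀ n → AllPairs _>_ (applyDownFrom suc n)
downFrom-decreasing n = AllPairsₚ.applyDownFrom⁺₁ suc n (λ j<i _ → s≤s j<i)

module Recursion (y q : ℕ) where

  open Weights y q
  open Gaussian q

  γ γ~ : ℕ → ℕ
  γ  n = weightSum  (applyDownFrom suc n)
  γ~ n = weightSum~ (applyDownFrom suc n)

  glueγ : ℕ → ℕ → ℕ
  glueγ a       zero    = γ a
  glueγ zero    (suc b) = 0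
  glueγ (suc a) (suc b) = y * q ^ suc b * γ (suc a) * γ (suc b)

  glueγ~ : ℕ → ℕ → ℕ
  glueγ~ zero    zero    = 0
  glueγ~ (suc a) zero    = y * γ (suc a)
  glueγ~ zero    (suc b) = 0
  glueγ~ (suc a) (suc b) = y * q ^ suc b * γ (suc a) * γ~ (suc b)

  convolve : (ℕ → ℕ → ℕ) → ℕ → ℕ
  convolve φ k = sumBelow (suc k) (λ i → gaussian k i * φ (k ∸ i) i)

  LengthDetermined : List ℕ → Set
  LengthDetermined L = weightSum L ≡ γ (length L) × weightSum~ L ≡ γ~ (length L)

  gluedWeight≡glueγ : ∀ A B → LengthDetermined A → LengthDetermined B →
                      gluedWeight A B ≡ glueγ (length A) (length B)
  gluedWeight≡glueγ A       []      (wA , _) _        = wA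
  gluedWeight≡glueγ []      (b ∷ B) _        _        = refl
  gluedWeight≡glueγ (a ∷ A) (b ∷ B) (wA , _) (wB , _) = cong₂ (λ u v → y * q ^ length (b ∷ B) * u * v) wA wB

  gluedWeight~≡glueγ~ : ∀ A B → LengthDetermined A → LengthDetermined B →
                        gluedWeight~ A B ≡ glueγ~ (length A) (length B)
  gluedWeight~≡glueγ~ []      []      _        _         = refl
  gluedWeight~≡glueγ~ (a ∷ A) []      (wA , _) _         = cong (y *_) wA
  gluedWeight~≡glueγ~ []      (b ∷ B) _        _         = refl
  gluedWeight~≡glueγ~ (a ∷ A) (b ∷ B) (wA , _) (_ , w~B) = cong₂ (λ u v → y * q ^ length (b ∷ B) * u * v) wA w~B

  weightSum-max-∷-convolve : ∀ {m} L → All (_< m) L → AllPairs _>_ L →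
    (∀ {A B} → Interleaving A B L → LengthDetermined A × LengthDetermined B) →
    weightSum (m ∷ L) ≡ convolve glueγ (length L) × weightSum~ (m ∷ L) ≡ convolve glueγ~ (length L)
  weightSum-max-∷-convolve L L<m L-decr blocks =
    trans (weightSum-max-∷ L L<m)
      (trans (sumInterleavings-cong L (λ {A} {B} s →
                cong (q ^ crossInversions A B *_) (gluedWeight≡glueγ A B (proj₁ (blocks s)) (proj₂ (blocks s)))))
             (sumInterleavings-crossInversions L L-decr glueγ)) ,
    trans (weightSum~-max-∷ L L<m)
      (trans (sumInterleavings-cong L (λ {A} {B} s →
                cong (q ^ crossInversions A B *_) (gluedWeight~≡glueγ~ A B (proj₁ (blocks s)) (proj₂ (blocks s)))))
             (sumInterleavings-crossInversions L L-decr glueγ~))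

  mutual
    decreasing-lengthDetermined : ∀ n L → AllPairs _>_ L → length L ≤ n → LengthDetermined L
    decreasing-lengthDetermined n       []      _              _           = refl , refl
    decreasing-lengthDetermined (suc n) (m ∷ L) (L<m ∷ L-decr) (s≤s |L|≤n) =
      trans (proj₁ split) (sym (proj₁ down)) , trans (proj₂ split) (sym (proj₂ down))
      where
      split : weightSum (m ∷ L) ≡ convolve glueγ (length L) × weightSum~ (m ∷ L) ≡ convolve glueγ~ (length L)
      split = weightSum-max-∷-convolve L L<m L-decr (λ s → blocks-lengthDetermined n s L-decr |L|≤n)
      down : γ (suc (length L)) ≡ convolve glueγ (length L) × γ~ (suc (length L)) ≡ convolve glueγ~ (length L)
      down = downFrom-convolve n (length L) |L|≤n

    blocks-lengthDetermined : ∀ n {A B L} → Interleaving A B L → AllPairs _>_ L → length L ≤ n →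
                              LengthDetermined A × LengthDetermined B
    blocks-lengthDetermined n s L-decr |L|≤n =
      decreasing-lengthDetermined n _ (proj₁ (AllPairs-interleaving s L-decr))
        (≤-trans (≤-trans (m≤m+n _ _) (≤-reflexive (sym (interleave-length s)))) |L|≤n) ,
      decreasing-lengthDetermined n _ (proj₂ (AllPairs-interleaving s L-decr))
        (≤-trans (≤-trans (m≤n+m _ _) (≤-reflexive (sym (interleave-length s)))) |L|≤n)

    downFrom-convolve : ∀ n k → k ≤ n → γ (suc k) ≡ convolve glueγ k × γ~ (suc k) ≡ convolve glueγ~ k
    downFrom-convolve n k k≤n =
      subst (λ l → γ (suc k) ≡ convolve glueγ l × γ~ (suc k) ≡ convolve glueγ~ l) (length-applyDownFrom suc k)
        (weightSum-max-∷-convolve (applyDownFrom suc k) (AllPairs.head (downFrom-decreasing (suc k)))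
          (downFrom-decreasing k)
          (λ s → blocks-lengthDetermined n s (downFrom-decreasing k)
                   (≤-trans (≤-reflexive (length-applyDownFrom suc k)) k≤n)))

  γ-convolve : ∀ k → γ (suc k) ≡ convolve glueγ k × γ~ (suc k) ≡ convolve glueγ~ k
  γ-convolve k = downFrom-convolve k k ≤-refl

  convolve-split : ∀ φ n → φ 0 (suc n) ≡ 0 →
    convolve φ (suc n) ≡ φ (suc n) 0 + sumBelow n (λ j → gaussian (suc n) (suc j) * φ (n ∸ j) (suc j))
  convolve-split φ n φ0≡0 = cong₂ _+_ (*-identityˡ (φ (suc n) 0)) (begin
    sumBelow (suc n) term                 ≡⟨ sumBelow-suc n term ⟩
    sumBelow n term + term n
                                          ≡⟨ cong (λ e → sumBelow n term + gaussian (suc n) (suc n) * φ e (suc n))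
                                                  (n∸n≡0 n) ⟩
    sumBelow n term + gaussian (suc n) (suc n) * φ 0 (suc n)
                                          ≡⟨ cong (λ e → sumBelow n term + gaussian (suc n) (suc n) * e) φ0≡0 ⟩
    sumBelow n term + gaussian (suc n) (suc n) * 0
                                          ≡⟨ cong (sumBelow n term +_) (*-zeroʳ (gaussian (suc n) (suc n))) ⟩
    sumBelow n term + 0                   ≡⟨ +-identityʳ _ ⟩
    sumBelow n term                       ∎)
    where
    open ≡-Reasoning
    term : ℕ → ℕ
    term j = gaussian (suc n) (suc j) * φ (n ∸ j) (suc j)

  glueγ-term : ∀ {n j} → j < n → ∀ G →
    G * glueγ (n ∸ j) (suc j) ≡ y * (q ^ suc j * G * γ (suc j) * γ (n ∸ j))
  glueγ-term {n} {j} j<n G rewrite +-∸-assoc 1 j<n = rearrange y (q ^ suc j) G (γ (suc (n ∸ suc j))) (γ (suc j))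
    where
    rearrange : ∀ y Q G A B → G * (y * Q * A * B) ≡ y * (Q * G * B * A)
    rearrange = solve-∀

  glueγ~-term : ∀ {n j} → j < n → ∀ G →
    G * glueγ~ (n ∸ j) (suc j) ≡ y * (q ^ suc j * G * γ~ (suc j) * γ (n ∸ j))
  glueγ~-term {n} {j} j<n G rewrite +-∸-assoc 1 j<n = rearrange y (q ^ suc j) G (γ (suc (n ∸ suc j))) (γ~ (suc j))
    where
    rearrange : ∀ y Q G A B → G * (y * Q * A * B) ≡ y * (Q * G * B * A)
    rearrange = solve-∀

module _ (y q : ℕ) where

  open Weights y q
  open Recursion y q

  Γ-term : ℕ → List ℕ → ℕ
  Γ-term k σ = (if (dd σ ≡ᵇ 0) ∧ (des σ ≡ᵇ k) then q ^ inv σ else 0) * y ^ k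

  Γ~-term : ℕ → List ℕ → ℕ
  Γ~-term i σ = (if (dd σ ≡ᵇ 0) ∧ (des σ ≡ᵇ i) then (if lastAscent σ then q ^ inv σ else 0) else 0) * y ^ suc i

  weight-as-sumBelow : ∀ m σ → length σ ≡ suc m →
    sumBelow (suc ⌊ m /2⌋) (λ k → Γ-term k σ) ≡ weight σ
  weight-as-sumBelow m σ len with dd σ in dd≡
  ... | suc _ = sumBelow-zero (suc ⌊ m /2⌋)
  ... | zero  = trans (sumBelow-≡ᵇ (q ^ inv σ) (y ^_) (s≤s (des-bound-dd σ dd≡ len))) (sym (+-identityʳ _))

  weight~-as-sumBelow : ∀ m σ → length σ ≡ suc m →
    sumBelow ⌊ suc m /2⌋ (λ i → Γ~-term i σ) ≡ weight~ σ
  weight~-as-sumBelow m σ len with dd σ in dd≡ | lastAscent σ in asc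
  ... | suc _ | b     = trans (sumBelow-zero ⌊ suc m /2⌋)
                              (sym (trans (cong (fromBool b *_) (*-zeroʳ y)) (*-zeroʳ (fromBool b))))
  ... | zero  | false = trans (sumBelow-cong ⌊ suc m /2⌋ (λ {i} _ → cong (_* y ^ suc i) (if-constant (des σ ≡ᵇ i))))
                              (sumBelow-zero ⌊ suc m /2⌋)
    where
    if-constant : ∀ b → (if b then 0 else 0) ≡ 0
    if-constant true  = refl
    if-constant false = refl
  ... | zero  | true  = trans (sumBelow-≡ᵇ (q ^ inv σ) (λ i → y ^ suc i) (des-bound-dd-lastAscent σ dd≡ asc len))
                              (rearrange y (q ^ inv σ) (y ^ des σ))
    where
    rearrange : ∀ y Q Y → Q * (y * Y) ≡ 1 * (y * (1 * (Q * Y)))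
    rearrange = solve-∀

  Γ≡γ : ∀ n → Γ n y q ≡ γ n
  Γ≡γ zero    = refl
  Γ≡γ (suc m) = begin
    sumBy (upTo (suc ⌊ m /2⌋)) (λ k → invSum q (D (suc m) k) * y ^ k)
      ≡⟨ sumBy-applyUpTo (suc ⌊ m /2⌋) (λ k → k) (λ k → invSum q (D (suc m) k) * y ^ k) ⟩
    sumBelow (suc ⌊ m /2⌋) (λ k → invSum q (D (suc m) k) * y ^ k)
      ≡⟨ sumBelow-cong (suc ⌊ m /2⌋) (λ {k} _ →
           trans (cong (_* y ^ k) (sumBy-filter (λ σ → (dd σ ≡ᵇ 0) ∧ (des σ ≡ᵇ k)) (S (suc m)) (λ σ → q ^ inv σ)))
                 (sym (sumBy-*ʳ (S (suc m)) (y ^ k) (λ σ → if (dd σ ≡ᵇ 0) ∧ (des σ ≡ᵇ k) then q ^ inv σ else 0)))) ⟩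
    sumBelow (suc ⌊ m /2⌋) (λ k → sumBy (S (suc m)) (Γ-term k))
      ≡⟨ sumBelow-sumBy (suc ⌊ m /2⌋) (S (suc m)) Γ-term ⟩
    sumBy (S (suc m)) (λ σ → sumBelow (suc ⌊ m /2⌋) (λ k → Γ-term k σ))
      ≡⟨ sumBy-permutations-cong (oneTo (suc m)) (λ {σ} σ↭ →
           weight-as-sumBelow m σ (trans (↭ₚ.↭-length σ↭) (length-oneTo (suc m)))) ⟩
    sumBy (S (suc m)) weight
      ≡⟨ sumBy-permutations-↭ (oneTo↭downFrom (suc m)) weight ⟩
    γ (suc m) ∎
    where open ≡-Reasoning

  Γ~≡γ~ : ∀ m → Γ~ (suc m) y q ≡ γ~ (suc m)
  Γ~≡γ~ m = begin
    sumBy (upTo ⌊ suc m /2⌋) (λ i → invSum q (D~ (suc m) (suc i)) * y ^ suc i)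
      ≡⟨ sumBy-applyUpTo ⌊ suc m /2⌋ (λ i → i) (λ i → invSum q (D~ (suc m) (suc i)) * y ^ suc i) ⟩
    sumBelow ⌊ suc m /2⌋ (λ i → invSum q (D~ (suc m) (suc i)) * y ^ suc i)
      ≡⟨ sumBelow-cong ⌊ suc m /2⌋ (λ {i} _ →
           trans (cong (_* y ^ suc i) (trans (sumBy-filter lastAscent (D (suc m) i) (λ σ → q ^ inv σ))
                                             (sumBy-filter (λ σ → (dd σ ≡ᵇ 0) ∧ (des σ ≡ᵇ i)) (S (suc m)) ascending)))
                 (sym (sumBy-*ʳ (S (suc m)) (y ^ suc i) (λ σ → if (dd σ ≡ᵇ 0) ∧ (des σ ≡ᵇ i) then ascending σ else 0)))) ⟩
    sumBelow ⌊ suc m /2⌋ (λ i → sumBy (S (suc m)) (Γ~-term i))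
      ≡⟨ sumBelow-sumBy ⌊ suc m /2⌋ (S (suc m)) Γ~-term ⟩
    sumBy (S (suc m)) (λ σ → sumBelow ⌊ suc m /2⌋ (λ i → Γ~-term i σ))
      ≡⟨ sumBy-permutations-cong (oneTo (suc m)) (λ {σ} σ↭ →
           weight~-as-sumBelow m σ (trans (↭ₚ.↭-length σ↭) (length-oneTo (suc m)))) ⟩
    sumBy (S (suc m)) weight~
      ≡⟨ sumBy-permutations-↭ (oneTo↭downFrom (suc m)) weight~ ⟩
    γ~ (suc m) ∎
    where
    open ≡-Reasoning
    ascending : List ℕ → ℕ
    ascending σ = if lastAscent σ then q ^ inv σ else 0

  open Gaussian q using (gaussian; qBinom≡gaussian)

  glueγ-sum : 2 ≤ q → ∀ n →
    sumBelow n (λ j → gaussian (suc n) (suc j) * glueγ (n ∸ j) (suc j)) ≡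
    y * sumFromTo 1 n (λ i → q ^ i * qBinom q (suc n) i * Γ i y q * Γ (suc n ∸ i) y q)
  glueγ-sum 2≤q n = begin
    sumBelow n (λ j → gaussian (suc n) (suc j) * glueγ (n ∸ j) (suc j))
      ≡⟨ sumBelow-cong n term ⟩
    sumBelow n (λ j → y * F (suc j))
      ≡⟨ sumBelow-*ˡ n y (F ∘ suc) ⟩
    y * sumBelow n (F ∘ suc)
      ≡⟨ cong (y *_) (sumBy-applyUpTo n (λ i → i) (F ∘ suc)) ⟨
    y * sumFromTo 1 n F ∎
    where
    open ≡-Reasoning
    F : ℕ → ℕ
    F i = q ^ i * qBinom q (suc n) i * Γ i y q * Γ (suc n ∸ i) y q
    term : ∀ {j} → j < n → gaussian (suc n) (suc j) * glueγ (n ∸ j) (suc j) ≡ y * F (suc j)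
    term {j} j<n = trans (glueγ-term j<n (gaussian (suc n) (suc j))) (cong (y *_) (cong₂ _*_
      (cong₂ (λ g a → q ^ suc j * g * a) (sym (qBinom≡gaussian 2≤q (s≤s (<⇒≤ j<n)))) (sym (Γ≡γ (suc j))))
      (sym (Γ≡γ (n ∸ j)))))

  glueγ~-sum : 2 ≤ q → ∀ n →
    sumBelow n (λ j → gaussian (suc n) (suc j) * glueγ~ (n ∸ j) (suc j)) ≡
    y * sumFromTo 2 n (λ i → q ^ i * qBinom q (suc n) i * Γ~ i y q * Γ (suc n ∸ i) y q)
  glueγ~-sum 2≤q zero    = sym (*-zeroʳ y)
  glueγ~-sum 2≤q (suc n) = begin
    G 1 * glueγ~ (suc n) 1 + sumBelow n (λ j → G (2 + j) * glueγ~ (n ∸ j) (2 + j))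
      ≡⟨ cong₂ _+_ singleton-block (sumBelow-cong n term) ⟩
    0 + sumBelow n (λ j → y * F (2 + j))
      ≡⟨ sumBelow-*ˡ n y (λ j → F (2 + j)) ⟩
    y * sumBelow n (λ j → F (2 + j))
      ≡⟨ cong (y *_) (sumBy-applyUpTo n (λ i → i) (λ j → F (2 + j))) ⟨
    y * sumFromTo 2 (suc n) F ∎
    where
    open ≡-Reasoning
    G : ℕ → ℕ
    G = gaussian (suc (suc n))
    F : ℕ → ℕ
    F i = q ^ i * qBinom q (suc (suc n)) i * Γ~ i y q * Γ (suc (suc n) ∸ i) y q
    -- γ~ 1 is 0: a one-letter permutation does not end in an ascent.
    singleton-block : G 1 * glueγ~ (suc n) 1 ≡ 0
    singleton-block = trans (cong (G 1 *_) (*-zeroʳ (y * q ^ 1 * γ (suc n)))) (*-zeroʳ (G 1))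
    term : ∀ {j} → j < n → G (2 + j) * glueγ~ (n ∸ j) (2 + j) ≡ y * F (2 + j)
    term {j} j<n = trans (glueγ~-term (s≤s j<n) (G (2 + j))) (cong (y *_) (cong₂ _*_
      (cong₂ (λ g a → q ^ (2 + j) * g * a) (sym (qBinom≡gaussian 2≤q (s≤s (s≤s (<⇒≤ j<n))))) (sym (Γ~≡γ~ (suc j))))
      (sym (Γ≡γ (n ∸ j)))))

  Γ-recurrence : 2 ≤ q → ∀ n →
    Γ (suc (suc n)) y q ≡
    Γ (suc n) y q + y * sumFromTo 1 (suc n ∸ 1) (λ i → q ^ i * qBinom q (suc n) i * Γ i y q * Γ (suc n ∸ i) y q)
  Γ-recurrence 2≤q n = begin
    Γ (suc (suc n)) y q
      ≡⟨ Γ≡γ (suc (suc n)) ⟩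
    γ (suc (suc n))
      ≡⟨ proj₁ (γ-convolve (suc n)) ⟩
    convolve glueγ (suc n)
      ≡⟨ convolve-split glueγ n refl ⟩
    γ (suc n) + sumBelow n (λ j → gaussian (suc n) (suc j) * glueγ (n ∸ j) (suc j))
      ≡⟨ cong₂ _+_ (sym (Γ≡γ (suc n))) (glueγ-sum 2≤q n) ⟩
    Γ (suc n) y q + y * sumFromTo 1 n (λ i → q ^ i * qBinom q (suc n) i * Γ i y q * Γ (suc n ∸ i) y q) ∎
    where open ≡-Reasoning

  Γ~-recurrence : 2 ≤ q → ∀ n →
    Γ~ (suc (suc n)) y q ≡
    y * Γ (suc n) y q + y * sumFromTo 2 (suc n ∸ 1) (λ i → q ^ i * qBinom q (suc n) i * Γ~ i y q * Γ (suc n ∸ i) y q)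
  Γ~-recurrence 2≤q n = begin
    Γ~ (suc (suc n)) y q
      ≡⟨ Γ~≡γ~ (suc n) ⟩
    γ~ (suc (suc n))
      ≡⟨ proj₂ (γ-convolve (suc n)) ⟩
    convolve glueγ~ (suc n)
      ≡⟨ convolve-split glueγ~ n refl ⟩
    y * γ (suc n) + sumBelow n (λ j → gaussian (suc n) (suc j) * glueγ~ (n ∸ j) (suc j))
      ≡⟨ cong₂ _+_ (cong (y *_) (sym (Γ≡γ (suc n)))) (glueγ~-sum 2≤q n) ⟩
    y * Γ (suc n) y q + y * sumFromTo 2 n (λ i → q ^ i * qBinom q (suc n) i * Γ~ i y q * Γ (suc n ∸ i) y q) ∎
    where open ≡-Reasoning

proposition5p2 : (y q : ℕ) → 2 ≤ q →
    (Γ 0 y q ≡ 1 × Γ 1 y q ≡ 1 × Γ~ 0 y q ≡ 1 × Γ~ 1 y q ≡ 0) ×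
    ((n : ℕ) → 1 ≤ n →
      (Γ (suc n) y q ≡ Γ n y q
          + y * sumFromTo 1 (n ∸ 1) (λ i → q ^ i * qBinom q n i * Γ i y q * Γ (n ∸ i) y q))
      × (Γ~ (suc n) y q ≡ y * Γ n y q
          + y * sumFromTo 2 (n ∸ 1) (λ i → q ^ i * qBinom q n i * Γ~ i y q * Γ (n ∸ i) y q)))
proposition5p2 y q 2≤q = (refl , refl , refl , refl) , λ
  { zero    ()
  ; (suc n) _ → Γ-recurrence y q 2≤q n , Γ~-recurrence y q 2≤q n
  }
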